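{- Let $S$ be a finite subset of $\mathcal{H}_+$ and $G=C(D_S)$, whose vertices are the points of $S$. Suppose $u,v,w,x\in S$ induce in $G$ a diamond $K_4-e$ with $e=vx$ (i.e., all pairs among $u,v,w,x$ are adjacent except $v$ and $x$). Let $k\in\{1,2,3\}$ and suppose the sequence $(u,v,w)$ is consecutively tail-biting in Type $k$. Let $\{i,j,k\}=\{1,2,3\}$. Then exactly one of the following holds: either $p_i^{(x)}\in R_i(v)$ and $p_j^{(x)}\notin R_j(v)$, or $p_i^{(x)}\notin R_i(v)$ and $p_j^{(x)}\in R_j(v)$.
   Context: For $x,y\in\mathbb{R}^3$ write $x\prec y$ if $x_l<y_l$ for $l=1,2,3$. For finite $S\subseteq\mathbb{R}^3$, $D_S$ is the digraph on $S$ with arcs $(x,v)$ whenever $v\prec x$; $C(D_S)$ has vertex set $S$, with distinct $x,y$ adjacent iff there is $z\in S$ with $z\prec x$, $z\prec y$. Let $\mathcal{H}_+=\{x\in\mathbb{R}^3:x_1+x_2+x_3>0\}$. For $v\in\mathcal{H}_+$ let $p_1^{(v)}=(-v_2-v_3,v_2,v_3)$, $p_2^{(v)}=(v_1,-v_1-v_3,v_3)$, $p_3^{(v)}=(v_1,v_2,-v_1-v_2)$, $\triangle(v)=\mathrm{Conv}(p_1^{(v)},p_2^{(v)},p_3^{(v)})$, $A(v)=\{\sum_l\lambda_lp_l^{(v)}:\sum_l\lambda_l=1,\lambda_l>0\}$. For $\{i,j,k\}=\{1,2,3\}$, $R_k(v)=\{(1+\alpha+\beta)p_k^{(v)}-\alpha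 p_i^{(v)}-\beta p_j^{(v)}:\alpha,\beta\ge0\}$. Points $v,w$ are crossing if $A(v)\cap A(w)$, $A(v)\setminus A(w)$, $A(w)\setminus A(v)$ are all nonempty; $x\stackrel{k}{\rightarrow}y$ means $x,y$ are crossing and $p_k^{(y)}\in\triangle(x)$. A sequence $(v_1,\dots,v_m)$, $m\ge2$, is consecutively tail-biting in Type $k$ if $v_a\stackrel{k}{\rightarrow}v_b$ for all $a<b$. -}

module Defs where

open import Data.Fin using (Fin; zero; suc)
open import Data.Product using (Σ; ∃; _×_; _,_)
open import Data.Sum using (_⊎_)
open import Data.Empty using (⊥)
open import Relation.Nullary using (¬_)
open import Relation.Binary.PropositionalEquality using (_≡_; _≢_)
open import Relation.Binary.Definitions using (Tri)
open import Data.List using (List)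
open import Data.List.Membership.Propositional using (_∈_)

-- The real numbers, axiomatised as a Dedekind-complete ordered field.
-- (agda-stdlib has no reals; every model of this record is isomorphic
-- to ℝ, so quantifying over all models is the statement about ℝ.)

record RealField : Set₁ where
  infixl 6 _+_ _-_
  infixl 7 _*_
  infix  4 _<_ _≤_
  field
    Carrier : Set
    0# 1#   : Carrier
    _+_ _*_ : Carrier → Carrier → Carrier
    -_      : Carrier → Carrier
    _⁻¹     : (x : Carrier) → x ≢ 0# → Carrier
    _<_     : Carrier → Carrier → Set
    +-assoc  : ∀ x y z → (x + y) + z ≡ x + (y + z)
    +-comm   : ∀ x y → x + y ≡ y + x
    +-idˡ    : ∀ x → 0# + x ≡ x
    +-invˡ   : ∀ x → (- x) + x ≡ 0#
    *-assoc  : ∀ x y z → (x * y) * z ≡ x * (y * z)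
    *-comm   : ∀ x y → x * y ≡ y * x
    *-idˡ    : ∀ x → 1# * x ≡ x
    *-invˡ   : ∀ x (nz : x ≢ 0#) → (x ⁻¹) nz * x ≡ 1#
    distribˡ : ∀ x y z → x * (y + z) ≡ x * y + x * z
    0≢1      : 0# ≢ 1#
    <-irrefl : ∀ x → ¬ (x < x)
    <-trans  : ∀ {x y z} → x < y → y < z → x < z
    <-tri    : ∀ x y → Tri (x < y) (x ≡ y) (y < x)
    +-mono-< : ∀ {x y} z → x < y → x + z < y + z
    *-pos    : ∀ {x y} → 0# < x → 0# < y → 0# < x * y
    sup      : (P : Carrier → Set) → Σ Carrier P →
               Σ Carrier (λ b → ∀ x → P x → (x < b ⊎ x ≡ b)) →
               Σ Carrier (λ s → (∀ x → P x → (x < s ⊎ x ≡ s)) ×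
                 (∀ b → (∀ x → P x → (x < b ⊎ x ≡ b)) → (s < b ⊎ s ≡ b)))

  _-_ : Carrier → Carrier → Carrier
  x - y = x + (- y)

  _≤_ : Carrier → Carrier → Set
  x ≤ y = x < y ⊎ x ≡ y

module Geometry (ℝ : RealField) where
  open RealField ℝ

  record Pt : Set where
    constructor ⟨_,_,_⟩
    field
      c₁ c₂ c₃ : Carrier

  open Pt public

  -- coordinate l (Fin 3: zero,suc zero,suc (suc zero) stand for 1,2,3)
  coord : Fin 3 → Pt → Carrier
  coord zero             x = c₁ x
  coord (suc zero)       x = c₂ x
  coord (suc (suc zero)) x = c₃ x

  _≺_ : Pt → Pt → Set
  x ≺ y = (c₁ x < c₁ y) × (c₂ x < c₂ y) × (c₃ x < c₃ y)

  _+ᵖ_ : Pt → Pt → Pt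
  x +ᵖ y = ⟨ c₁ x + c₁ y , c₂ x + c₂ y , c₃ x + c₃ y ⟩

  _·_ : Carrier → Pt → Pt
  a · x = ⟨ a * c₁ x , a * c₂ x , a * c₃ x ⟩

  H₊ : Pt → Set
  H₊ x = 0# < c₁ x + c₂ x + c₃ x

  -- the arc (x , v) of D_S exists iff v ≺ x; the competition graph C(D_S):
  -- distinct x , y ∈ S adjacent iff some z ∈ S has z ≺ x and z ≺ y
  Adj : List Pt → Pt → Pt → Set
  Adj S x y = x ≢ y × Σ Pt (λ z → z ∈ S × z ≺ x × z ≺ y)

  p : Fin 3 → Pt → Pt
  p zero             v = ⟨ (- c₂ v) - c₃ v , c₂ v , c₃ v ⟩
  p (suc zero)       v = ⟨ c₁ v , (- c₁ v) - c₃ v , c₃ v ⟩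
  p (suc (suc zero)) v = ⟨ c₁ v , c₂ v , (- c₁ v) - c₂ v ⟩

  comb : Pt → Carrier → Carrier → Carrier → Pt
  comb v a b c = ((a · p zero v) +ᵖ (b · p (suc zero) v)) +ᵖ (c · p (suc (suc zero)) v)

  Tri△ : Pt → Pt → Set
  Tri△ v y = Σ Carrier λ a → Σ Carrier λ b → Σ Carrier λ c →
    (0# ≤ a) × (0# ≤ b) × (0# ≤ c) × (a + b + c ≡ 1#) × (y ≡ comb v a b c)

  A : Pt → Pt → Set
  A v y = Σ Carrier λ a → Σ Carrier λ b → Σ Carrier λ c →
    (0# < a) × (0# < b) × (0# < c) × (a + b + c ≡ 1#) × (y ≡ comb v a b c)

  -- Ray k i j v = R_k(v) = {(1+α+β) p_k - α p_i - β p_j : α,β ≥ 0},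
  -- used only with {i,j,k} = {1,2,3} (the set is symmetric in i,j).
  Ray : Fin 3 → Fin 3 → Fin 3 → Pt → Pt → Set
  Ray k i j v y = Σ Carrier λ α → Σ Carrier λ β →
    (0# ≤ α) × (0# ≤ β) ×
    (y ≡ (((1# + α + β) · p k v) +ᵖ ((- α) · p i v)) +ᵖ ((- β) · p j v))

  Crossing : Pt → Pt → Set
  Crossing v w =
    Σ Pt (λ y → A v y × A w y) ×
    Σ Pt (λ y → A v y × ¬ A w y) ×
    Σ Pt (λ y → A w y × ¬ A v y)

  Arrow : Fin 3 → Pt → Pt → Set
  Arrow k x y = Crossing x y × Tri△ x (p k y)

  TailBiting3 : Fin 3 → Pt → Pt → Pt → Set
  TailBiting3 k u v w = Arrow k u v × Arrow k u w × Arrow k v w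

  Diamond : List Pt → Pt → Pt → Pt → Pt → Set
  Diamond S u v w x =
    (u ∈ S) × (v ∈ S) × (w ∈ S) × (x ∈ S) ×
    (u ≢ v) × (u ≢ w) × (u ≢ x) × (v ≢ w) × (v ≢ x) × (w ≢ x) ×
    Adj S u v × Adj S u w × Adj S u x × Adj S v w × Adj S w x ×
    ¬ Adj S v x

-- Write σ(y) = y₁ + y₂ + y₃ and let σ(v) > 0. Then p_k(v) is v with its k-th coordinate lowered
-- by σ(v), a point of the plane σ = 0; △(v) lies weakly and A(v) strictly below v in every
-- coordinate, A(v) is exactly the set of points of the plane strictly below v, and R_k(v) is the
-- set of points y of the plane with y_i ≥ v_i and y_j ≥ v_j. So x →ᵏ y puts y weakly below x off
-- coordinate k, and x_k < y_k since otherwise A(y) ⊆ A(x). In the diamond, w is below v off k and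
-- shares a prey with x while v does not, which forces v_k < x_k; hence p_i(x) ∈ R_i(v) iff
-- v_j ≤ x_j, and p_j(x) ∈ R_j(v) iff v_i ≤ x_i. If both held, a common prey of u and v would also
-- be one of x; if neither held, a common prey of u and x (below u, hence below v in coordinate k)
-- would be one of v.

module Submission where

open import Defs
open import Data.Fin using (Fin)
open import Data.List using (List)
open import Data.List.Relation.Unary.All using (All)
open import Data.Product using (_×_)
open import Data.Sum using (_⊎_)
open import Relation.Nullary using (¬_)
open import Relation.Binary.PropositionalEquality using (_≢_)

open import Algebra.Bundles using (CommutativeRing)
open import Algebra.Consequences.Propositional using (comm∧idˡ⇒id; comm∧invˡ⇒inv; comm∧distrˡ⇒distrʳ)
import Algebra.Properties.CommutativeSemigroup as CommutativeSemigroupProperties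
import Algebra.Properties.Ring as RingProperties
import Algebra.Properties.Semiring.Mult.TCOptimised as SemiringMultiplication
import Algebra.Solver.Ring
open import Algebra.Solver.Ring.AlmostCommutativeRing
  using (AlmostCommutativeRing; fromCommutativeRing; _-Raw-AlmostCommutative⟶_)
open import Algebra.Structures using (IsCommutativeRing)
open import Data.Empty using (⊥-elim)
open import Data.Fin using (_≟_)
open import Data.Fin.Patterns using (0F; 1F; 2F)
open import Data.Fin.Properties using (all?)
open import Data.Integer.Base as ℤ using (ℤ; -[1+_]; _⊖_; 0ℤ; 1ℤ)
import Data.Integer.Properties as ℤ
open import Data.List.Membership.Propositional using (_∈_)
import Data.List.Relation.Unary.All as ListAll
import Data.Maybe.Base as Maybe
open import Data.Nat.Base as ℕ using (zero; suc)
import Data.Nat.Properties as ℕ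
open import Data.Product using (_,_; proj₁; proj₂)
open import Data.Sign.Base as Sign using (Sign)
open import Data.Sum using (inj₁; inj₂)
open import Data.Vec.Base using (_∷_; []; lookup)
open import Data.Vec.Properties using (lookup∘tabulate)
open import Data.Vec.Relation.Unary.All using (_∷_; [])
open import Data.Vec.Relation.Unary.All.Properties using (lookup⁺)
open import Level using (0ℓ)
open import Function.Bundles using (_⇔_; mk⇔; Equivalence)
open import Relation.Binary.Definitions using (tri<; tri≈; tri>)
import Relation.Binary.Construct.StrictToNonStrict as StrictToNonStrict
open import Relation.Binary.PropositionalEquality
  using (_≡_; refl; sym; trans; cong; cong₂; subst; subst₂; resp₂; isEquivalence; ≢-sym; module ≡-Reasoning)
open import Relation.Nullary.Decidable using (yes; no; from-yes; ¬?; _→-dec_; _⊎-dec_; dec⇒maybe)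
open import Relation.Nullary.Negation using (contradiction)

distinct-cover : ∀ (i j k : Fin 3) → i ≢ j → j ≢ k → i ≢ k → ∀ l → l ≡ i ⊎ l ≡ j ⊎ l ≡ k
distinct-cover = from-yes (all? {3} λ i → all? {3} λ j → all? {3} λ k →
  ¬? (i ≟ j) →-dec ¬? (j ≟ k) →-dec ¬? (i ≟ k) →-dec
  all? {3} λ l → l ≟ i ⊎-dec l ≟ j ⊎-dec l ≟ k)

all-distinct : ∀ {p} {i j k : Fin 3} → i ≢ j → j ≢ k → i ≢ k →
  (P : Fin 3 → Set p) → P i → P j → P k → ∀ l → P l
all-distinct {i = i} {j} {k} i≢j j≢k i≢k P Pi Pj Pk l with distinct-cover i j k i≢j j≢k i≢k l
... | inj₁ refl        = Pi
... | inj₂ (inj₁ refl) = Pj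
... | inj₂ (inj₂ refl) = Pk

all-from-≢ : ∀ {n p} (P : Fin n → Set p) {k} → P k → (∀ {l} → k ≢ l → P l) → ∀ l → P l
all-from-≢ P {k} Pk P≢ l with k ≟ l
... | yes refl = Pk
... | no k≢l   = P≢ k≢l

exclusive-or : ∀ {a b c d} {P : Set a} {Q : Set b} {A : Set c} {B : Set d} →
  P ⇔ B → Q ⇔ A → A ⊎ B → ¬ (A × B) → (P × ¬ Q) ⊎ (¬ P × Q)
exclusive-or P⇔B Q⇔A (inj₁ a) ¬a×b =
  inj₂ ((λ p → ¬a×b (a , Equivalence.to P⇔B p)) , Equivalence.from Q⇔A a)
exclusive-or P⇔B Q⇔A (inj₂ b) ¬a×b =
  inj₁ (Equivalence.from P⇔B b , (λ q → ¬a×b (Equivalence.to Q⇔A q , b)))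

module FieldAlgebra (ℝ : RealField) where
  open RealField ℝ

  isCommutativeRing : IsCommutativeRing _≡_ _+_ _*_ -_ 0# 1#
  isCommutativeRing = record
    { isRing = record
      { +-isAbelianGroup = record
        { isGroup = record
          { isMonoid = record
            { isSemigroup = record
              { isMagma = record { isEquivalence = isEquivalence ; ∙-cong = cong₂ _+_ }
              ; assoc = +-assoc }
            ; identity = comm∧idˡ⇒id +-comm +-idˡ }
          ; inverse = comm∧invˡ⇒inv +-comm +-invˡ
          ; ⁻¹-cong = cong (-_) }
        ; comm = +-comm }
      ; *-cong = cong₂ _*_
      ; *-assoc = *-assoc
      ; *-identity = comm∧idˡ⇒id *-comm *-idˡ
      ; distrib = distribˡ , comm∧distrˡ⇒distrʳ *-comm distribˡ }
    ; *-comm = *-comm }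

  commutativeRing : CommutativeRing 0ℓ 0ℓ
  commutativeRing = record { isCommutativeRing = isCommutativeRing }

  open CommutativeRing commutativeRing public using (zeroˡ; +-identityʳ; -‿inverseʳ; *-identityʳ)
  open RingProperties (CommutativeRing.ring commutativeRing) public
    using (-‿involutive; -0#≈0#; -‿+-comm; -‿distribˡ-*; -‿distribʳ-*; +-cancelˡ)
  open SemiringMultiplication (CommutativeRing.semiring commutativeRing)
    using (×-homo-+; ×1-homo-*; 1+×) renaming (_×_ to _×ₙ_)
  open CommutativeSemigroupProperties (CommutativeRing.+-commutativeSemigroup commutativeRing)
    using (interchange)
  open ≡-Reasoning

  -- Integer coefficients for the ring solver, whose normal forms compare coefficients in ℤ.
  -- The optimised multiple _×ₙ_ has 1 ×ₙ x = x definitionally, so con 1ℤ denotes 1# itself.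
  fromℤ : ℤ → Carrier
  fromℤ (ℤ.+ n)  = n ×ₙ 1#
  fromℤ -[1+ n ] = - (suc n ×ₙ 1#)

  fromℤ-⊖ : ∀ m n → fromℤ (m ⊖ n) ≡ m ×ₙ 1# - n ×ₙ 1#
  fromℤ-⊖ zero    zero    = sym (-‿inverseʳ 0#)
  fromℤ-⊖ zero    (suc n) = sym (+-idˡ _)
  fromℤ-⊖ (suc m) zero    = sym (trans (cong ((suc m ×ₙ 1#) +_) -0#≈0#) (+-identityʳ _))
  fromℤ-⊖ (suc m) (suc n) = begin
    fromℤ (suc m ⊖ suc n)              ≡⟨ cong fromℤ (ℤ.[1+m]⊖[1+n]≡m⊖n m n) ⟩
    fromℤ (m ⊖ n)                      ≡⟨ fromℤ-⊖ m n ⟩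
    m ×ₙ 1# - n ×ₙ 1#                  ≡⟨ sym (+-idˡ _) ⟩
    0# + (m ×ₙ 1# - n ×ₙ 1#)           ≡⟨ cong (_+ (m ×ₙ 1# - n ×ₙ 1#)) (sym (-‿inverseʳ 1#)) ⟩
    (1# - 1#) + (m ×ₙ 1# - n ×ₙ 1#)    ≡⟨ interchange 1# (- 1#) (m ×ₙ 1#) (- (n ×ₙ 1#)) ⟩
    (1# + m ×ₙ 1#) + (- 1# - n ×ₙ 1#)  ≡⟨ cong ((1# + m ×ₙ 1#) +_) (-‿+-comm 1# (n ×ₙ 1#)) ⟩
    (1# + m ×ₙ 1#) - (1# + n ×ₙ 1#)    ≡⟨ sym (cong₂ _-_ (1+× m 1#) (1+× n 1#)) ⟩
    suc m ×ₙ 1# - suc n ×ₙ 1#          ∎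

  signed : Sign → Carrier → Carrier
  signed Sign.+ x = x
  signed Sign.- x = - x

  fromℤ-◃ : ∀ s n → fromℤ (s ℤ.◃ n) ≡ signed s (n ×ₙ 1#)
  fromℤ-◃ Sign.+ zero    = refl
  fromℤ-◃ Sign.- zero    = sym -0#≈0#
  fromℤ-◃ Sign.+ (suc n) = refl
  fromℤ-◃ Sign.- (suc n) = refl

  fromℤ-signAbs : ∀ i → fromℤ i ≡ signed (ℤ.sign i) (ℤ.∣ i ∣ ×ₙ 1#)
  fromℤ-signAbs (ℤ.+ zero)  = refl
  fromℤ-signAbs (ℤ.+ suc n) = refl
  fromℤ-signAbs -[1+ n ]    = refl

  signed-* : ∀ s t a b → signed (s Sign.* t) (a * b) ≡ signed s a * signed t b
  signed-* Sign.+ Sign.+ a b = refl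
  signed-* Sign.+ Sign.- a b = -‿distribʳ-* a b
  signed-* Sign.- Sign.+ a b = -‿distribˡ-* a b
  signed-* Sign.- Sign.- a b = begin
    a * b          ≡⟨ cong₂ _*_ (sym (-‿involutive a)) refl ⟩
    - - a * b      ≡⟨ sym (-‿distribˡ-* (- a) b) ⟩
    - (- a * b)    ≡⟨ -‿distribʳ-* (- a) b ⟩
    - a * - b      ∎

  fromℤ-+ : ∀ i j → fromℤ (i ℤ.+ j) ≡ fromℤ i + fromℤ j
  fromℤ-+ -[1+ m ] -[1+ n ] = begin
    - (suc (suc (m ℕ.+ n)) ×ₙ 1#)  ≡⟨ cong (λ t → - (t ×ₙ 1#)) (sym (ℕ.+-suc (suc m) n)) ⟩
    - ((suc m ℕ.+ suc n) ×ₙ 1#)    ≡⟨ cong (-_) (×-homo-+ 1# (suc m) (suc n)) ⟩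
    - (suc m ×ₙ 1# + suc n ×ₙ 1#)  ≡⟨ sym (-‿+-comm _ _) ⟩
    - (suc m ×ₙ 1#) - suc n ×ₙ 1#  ∎
  fromℤ-+ -[1+ m ] (ℤ.+ n)  = trans (fromℤ-⊖ n (suc m)) (+-comm _ _)
  fromℤ-+ (ℤ.+ m)  -[1+ n ] = fromℤ-⊖ m (suc n)
  fromℤ-+ (ℤ.+ m)  (ℤ.+ n)  = ×-homo-+ 1# m n

  fromℤ-* : ∀ i j → fromℤ (i ℤ.* j) ≡ fromℤ i * fromℤ j
  fromℤ-* i j = begin
    fromℤ (s ℤ.◃ ℤ.∣ i ∣ ℕ.* ℤ.∣ j ∣)
      ≡⟨ fromℤ-◃ s (ℤ.∣ i ∣ ℕ.* ℤ.∣ j ∣) ⟩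
    signed s ((ℤ.∣ i ∣ ℕ.* ℤ.∣ j ∣) ×ₙ 1#)
      ≡⟨ cong (signed s) (×1-homo-* ℤ.∣ i ∣ ℤ.∣ j ∣) ⟩
    signed s ((ℤ.∣ i ∣ ×ₙ 1#) * (ℤ.∣ j ∣ ×ₙ 1#))
      ≡⟨ signed-* (ℤ.sign i) (ℤ.sign j) _ _ ⟩
    signed (ℤ.sign i) (ℤ.∣ i ∣ ×ₙ 1#) * signed (ℤ.sign j) (ℤ.∣ j ∣ ×ₙ 1#)
      ≡⟨ sym (cong₂ _*_ (fromℤ-signAbs i) (fromℤ-signAbs j)) ⟩
    fromℤ i * fromℤ j
      ∎
    where
    s : Sign
    s = ℤ.sign i Sign.* ℤ.sign j

  fromℤ-neg : ∀ i → fromℤ (ℤ.- i) ≡ - fromℤ i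
  fromℤ-neg -[1+ n ]    = sym (-‿involutive _)
  fromℤ-neg (ℤ.+ zero)  = sym -0#≈0#
  fromℤ-neg (ℤ.+ suc n) = refl

  almostCommutativeRing : AlmostCommutativeRing 0ℓ 0ℓ
  almostCommutativeRing = fromCommutativeRing commutativeRing

  fromℤ-homomorphism : ℤ.+-*-rawRing -Raw-AlmostCommutative⟶ almostCommutativeRing
  fromℤ-homomorphism = record
    { ⟦_⟧ = fromℤ ; +-homo = fromℤ-+ ; *-homo = fromℤ-* ; -‿homo = fromℤ-neg
    ; 0-homo = refl ; 1-homo = refl }

  module Solver = Algebra.Solver.Ring ℤ.+-*-rawRing almostCommutativeRing fromℤ-homomorphism
    (λ i j → Maybe.map (cong fromℤ) (dec⇒maybe (i ℤ.≟ j)))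

module FieldOrder (ℝ : RealField) where
  open RealField ℝ
  open FieldAlgebra ℝ
  open Solver using (solve; _:=_; _:+_; _:-_)
  open StrictToNonStrict _≡_ _<_ public using (<⇒≤)

  <-≤-trans : ∀ {x y z} → x < y → y ≤ z → x < z
  <-≤-trans = StrictToNonStrict.<-≤-trans _≡_ _<_ <-trans (proj₁ (resp₂ _<_))

  ≤-<-trans : ∀ {x y z} → x ≤ y → y < z → x < z
  ≤-<-trans = StrictToNonStrict.≤-<-trans _≡_ _<_ sym <-trans (proj₂ (resp₂ _<_))

  <-or-≥ : ∀ x y → x < y ⊎ y ≤ x
  <-or-≥ x y with <-tri x y
  ... | tri< x<y _ _ = inj₁ x<y
  ... | tri≈ _ x≡y _ = inj₂ (inj₂ (sym x≡y))
  ... | tri> _ _ y<x = inj₂ (inj₁ y<x)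

  +-monoˡ-≤ : ∀ {x y} z → x ≤ y → x + z ≤ y + z
  +-monoˡ-≤ z (inj₁ x<y)  = inj₁ (+-mono-< z x<y)
  +-monoˡ-≤ z (inj₂ refl) = inj₂ refl

  x<y⇒0<y-x : ∀ {x y} → x < y → 0# < y - x
  x<y⇒0<y-x {x} x<y = subst (_< _) (-‿inverseʳ x) (+-mono-< (- x) x<y)

  x≤y⇒0≤y-x : ∀ {x y} → x ≤ y → 0# ≤ y - x
  x≤y⇒0≤y-x {x} x≤y = subst (_≤ _) (-‿inverseʳ x) (+-monoˡ-≤ (- x) x≤y)

  x+[y-x]≡y : ∀ x y → x + (y - x) ≡ y
  x+[y-x]≡y = solve 2 (λ x y → x :+ (y :- x) := y) refl

  0<d⇒x-d<x : ∀ x {d} → 0# < d → x - d < x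
  0<d⇒x-d<x x {d} 0<d = subst₂ _<_ (+-idˡ (x - d)) (x+[y-x]≡y d x) (+-mono-< (x - d) 0<d)

  0≤d⇒x-d≤x : ∀ x {d} → 0# ≤ d → x - d ≤ x
  0≤d⇒x-d≤x x {d} 0≤d = subst₂ _≤_ (+-idˡ (x - d)) (x+[y-x]≡y d x) (+-monoˡ-≤ (x - d) 0≤d)

  0≤d⇒x≤x+d : ∀ x {d} → 0# ≤ d → x ≤ x + d
  0≤d⇒x≤x+d x {d} 0≤d = subst₂ _≤_ (+-idˡ x) (+-comm d x) (+-monoˡ-≤ x 0≤d)

  0≤a⇒0≤a*b : ∀ {a b} → 0# ≤ a → 0# < b → 0# ≤ a * b
  0≤a⇒0≤a*b (inj₁ 0<a) 0<b = inj₁ (*-pos 0<a 0<b)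
  0≤a⇒0≤a*b (inj₂ refl) _ = inj₂ (sym (zeroˡ _))

  x<0⇒0<-x : ∀ {x} → x < 0# → 0# < - x
  x<0⇒0<-x {x} x<0 = subst₂ _<_ (-‿inverseʳ x) (+-idˡ (- x)) (+-mono-< (- x) x<0)

  0<1 : 0# < 1#
  0<1 with <-tri 0# 1#
  ... | tri< 0<1 _ _ = 0<1
  ... | tri≈ _ 0≡1 _ = ⊥-elim (0≢1 0≡1)
  ... | tri> _ _ 1<0 = ⊥-elim (<-irrefl 1# (<-trans 1<0 (subst (0# <_) [-1]*[-1]≡1 (*-pos 0<-1 0<-1))))
    where
    0<-1 : 0# < - 1#
    0<-1 = x<0⇒0<-x 1<0
    [-1]*[-1]≡1 : - 1# * - 1# ≡ 1#
    [-1]*[-1]≡1 = trans (sym (-‿distribˡ-* 1# (- 1#))) (trans (cong (-_) (*-idˡ (- 1#))) (-‿involutive 1#))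

  0<⇒≢0 : ∀ {s} → 0# < s → s ≢ 0#
  0<⇒≢0 0<s refl = <-irrefl 0# 0<s

  infixl 7 _÷⟨_⟩
  _÷⟨_⟩ : Carrier → ∀ {s} → 0# < s → Carrier
  d ÷⟨ 0<s ⟩ = d * (_ ⁻¹) (0<⇒≢0 0<s)

  ÷-*-cancel : ∀ d {s} (0<s : 0# < s) → d ÷⟨ 0<s ⟩ * s ≡ d
  ÷-*-cancel d {s} 0<s = begin
    d * s⁻¹ * s    ≡⟨ *-assoc d s⁻¹ s ⟩
    d * (s⁻¹ * s)  ≡⟨ cong (d *_) (*-invˡ s (0<⇒≢0 0<s)) ⟩
    d * 1#         ≡⟨ *-identityʳ d ⟩
    d              ∎
    where
    open ≡-Reasoning
    s⁻¹ : Carrier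
    s⁻¹ = (s ⁻¹) (0<⇒≢0 0<s)

  ÷-self : ∀ {s} (0<s : 0# < s) → s ÷⟨ 0<s ⟩ ≡ 1#
  ÷-self {s} 0<s = trans (*-comm s _) (*-invˡ s (0<⇒≢0 0<s))

  0<⁻¹ : ∀ {s} (0<s : 0# < s) → 0# < (s ⁻¹) (0<⇒≢0 0<s)
  0<⁻¹ {s} 0<s with <-tri 0# ((s ⁻¹) (0<⇒≢0 0<s))
  ... | tri< 0<s⁻¹ _ _ = 0<s⁻¹
  ... | tri≈ _ 0≡s⁻¹ _ = ⊥-elim (0≢1 (begin
    0#                      ≡⟨ sym (zeroˡ s) ⟩
    0# * s                  ≡⟨ cong (_* s) 0≡s⁻¹ ⟩
    (s ⁻¹) (0<⇒≢0 0<s) * s  ≡⟨ *-invˡ s (0<⇒≢0 0<s) ⟩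
    1#                      ∎))
    where open ≡-Reasoning
  ... | tri> _ _ s⁻¹<0 = ⊥-elim (<-irrefl 0# (<-trans 0<1 1<0))
    where
    0<-1 : 0# < - 1#
    0<-1 = subst (0# <_) (trans (sym (-‿distribˡ-* _ s)) (cong (-_) (*-invˡ s (0<⇒≢0 0<s))))
                 (*-pos (x<0⇒0<-x s⁻¹<0) 0<s)
    1<0 : 1# < 0#
    1<0 = subst₂ _<_ (+-idˡ 1#) (+-invˡ 1#) (+-mono-< 1# 0<-1)

  0≤d⇒0≤d÷s : ∀ {d s} (0<s : 0# < s) → 0# ≤ d → 0# ≤ d ÷⟨ 0<s ⟩
  0≤d⇒0≤d÷s 0<s 0≤d = 0≤a⇒0≤a*b 0≤d (0<⁻¹ 0<s)

  0<d⇒0<d÷s : ∀ {d s} (0<s : 0# < s) → 0# < d → 0# < d ÷⟨ 0<s ⟩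
  0<d⇒0<d÷s 0<s 0<d = *-pos 0<d (0<⁻¹ 0<s)

module Coordinates (ℝ : RealField) where
  open RealField ℝ
  open FieldAlgebra ℝ
  open FieldOrder ℝ
  open Geometry ℝ
  open Solver using (solve; _:=_; _:+_; _:*_; :-_; _:-_; con)
  open ≡-Reasoning

  σ : Pt → Carrier
  σ x = c₁ x + c₂ x + c₃ x

  Pt-ext : ∀ {x y} → (∀ l → coord l x ≡ coord l y) → x ≡ y
  Pt-ext {x} {y} eq = trans (cong (λ a → ⟨ a , c₂ x , c₃ x ⟩) (eq 0F))
                            (cong₂ (λ b c → ⟨ c₁ y , b , c ⟩) (eq 1F) (eq 2F))

  ≺⇒< : ∀ {x y} → x ≺ y → ∀ l → coord l x < coord l y
  ≺⇒< (x₁<y₁ , _ , _) 0F = x₁<y₁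
  ≺⇒< (_ , x₂<y₂ , _) 1F = x₂<y₂
  ≺⇒< (_ , _ , x₃<y₃) 2F = x₃<y₃

  <⇒≺ : ∀ {x y} → (∀ l → coord l x < coord l y) → x ≺ y
  <⇒≺ x<y = x<y 0F , x<y 1F , x<y 2F

  coord-sum : ∀ {i j k} → i ≢ j → j ≢ k → i ≢ k → ∀ x → coord i x + coord j x + coord k x ≡ σ x
  coord-sum {0F} {1F} {2F} _ _ _ x = refl
  coord-sum {0F} {2F} {1F} _ _ _ x = solve 3 (λ a b c → a :+ c :+ b := a :+ b :+ c) refl (c₁ x) (c₂ x) (c₃ x)
  coord-sum {1F} {0F} {2F} _ _ _ x = solve 3 (λ a b c → b :+ a :+ c := a :+ b :+ c) refl (c₁ x) (c₂ x) (c₃ x)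
  coord-sum {1F} {2F} {0F} _ _ _ x = solve 3 (λ a b c → b :+ c :+ a := a :+ b :+ c) refl (c₁ x) (c₂ x) (c₃ x)
  coord-sum {2F} {0F} {1F} _ _ _ x = solve 3 (λ a b c → c :+ a :+ b := a :+ b :+ c) refl (c₁ x) (c₂ x) (c₃ x)
  coord-sum {2F} {1F} {0F} _ _ _ x = solve 3 (λ a b c → c :+ b :+ a := a :+ b :+ c) refl (c₁ x) (c₂ x) (c₃ x)
  coord-sum {0F} {0F}      i≢j _   _   = contradiction refl i≢j
  coord-sum {1F} {1F}      i≢j _   _   = contradiction refl i≢j
  coord-sum {2F} {2F}      i≢j _   _   = contradiction refl i≢j
  coord-sum {0F} {1F} {0F} _   _   i≢k = contradiction refl i≢k
  coord-sum {0F} {1F} {1F} _   j≢k _   = contradiction refl j≢k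
  coord-sum {0F} {2F} {0F} _   _   i≢k = contradiction refl i≢k
  coord-sum {0F} {2F} {2F} _   j≢k _   = contradiction refl j≢k
  coord-sum {1F} {0F} {0F} _   j≢k _   = contradiction refl j≢k
  coord-sum {1F} {0F} {1F} _   _   i≢k = contradiction refl i≢k
  coord-sum {1F} {2F} {1F} _   _   i≢k = contradiction refl i≢k
  coord-sum {1F} {2F} {2F} _   j≢k _   = contradiction refl j≢k
  coord-sum {2F} {0F} {0F} _   j≢k _   = contradiction refl j≢k
  coord-sum {2F} {0F} {2F} _   _   i≢k = contradiction refl i≢k
  coord-sum {2F} {1F} {1F} _   j≢k _   = contradiction refl j≢k
  coord-sum {2F} {1F} {2F} _   _   i≢k = contradiction refl i≢k

  σ-ext : ∀ {i j k} → i ≢ j → j ≢ k → i ≢ k → ∀ {x y} → σ x ≡ σ y →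
    coord i x ≡ coord i y → coord j x ≡ coord j y → x ≡ y
  σ-ext {i} {j} {k} i≢j j≢k i≢k {x} {y} σx≡σy xᵢ≡yᵢ xⱼ≡yⱼ =
    Pt-ext (all-distinct i≢j j≢k i≢k (λ l → coord l x ≡ coord l y) xᵢ≡yᵢ xⱼ≡yⱼ xₖ≡yₖ)
    where
    xₖ≡yₖ : coord k x ≡ coord k y
    xₖ≡yₖ = +-cancelˡ (coord i y + coord j y) _ _ (begin
      coord i y + coord j y + coord k x  ≡⟨ cong₂ (λ a b → a + b + coord k x) (sym xᵢ≡yᵢ) (sym xⱼ≡yⱼ) ⟩
      coord i x + coord j x + coord k x  ≡⟨ coord-sum i≢j j≢k i≢k x ⟩
      σ x                                ≡⟨ σx≡σy ⟩
      σ y                                ≡⟨ coord-sum i≢j j≢k i≢k y ⟨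
      coord i y + coord j y + coord k y  ∎)

  coord-combination : ∀ l a b c x y z →
    coord l (((a · x) +ᵖ (b · y)) +ᵖ (c · z)) ≡ a * coord l x + b * coord l y + c * coord l z
  coord-combination 0F a b c x y z = refl
  coord-combination 1F a b c x y z = refl
  coord-combination 2F a b c x y z = refl

  σ-combination : ∀ a b c x y z →
    σ (((a · x) +ᵖ (b · y)) +ᵖ (c · z)) ≡ a * σ x + b * σ y + c * σ z
  σ-combination a b c x y z = solve 12
    (λ a b c x₁ x₂ x₃ y₁ y₂ y₃ z₁ z₂ z₃ →
      (a :* x₁ :+ b :* y₁ :+ c :* z₁) :+ (a :* x₂ :+ b :* y₂ :+ c :* z₂) :+ (a :* x₃ :+ b :* y₃ :+ c :* z₃)
      := a :* (x₁ :+ x₂ :+ x₃) :+ b :* (y₁ :+ y₂ :+ y₃) :+ c :* (z₁ :+ z₂ :+ z₃))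
    refl a b c (c₁ x) (c₂ x) (c₃ x) (c₁ y) (c₂ y) (c₃ y) (c₁ z) (c₂ z) (c₃ z)

  coord-p-≢ : ∀ {m l} → m ≢ l → ∀ v → coord l (p m v) ≡ coord l v
  coord-p-≢ {0F} {0F} m≢l = contradiction refl m≢l
  coord-p-≢ {0F} {1F} _ v = refl
  coord-p-≢ {0F} {2F} _ v = refl
  coord-p-≢ {1F} {0F} _ v = refl
  coord-p-≢ {1F} {1F} m≢l = contradiction refl m≢l
  coord-p-≢ {1F} {2F} _ v = refl
  coord-p-≢ {2F} {0F} _ v = refl
  coord-p-≢ {2F} {1F} _ v = refl
  coord-p-≢ {2F} {2F} m≢l = contradiction refl m≢l

  coord-p-≡ : ∀ m v → coord m (p m v) ≡ coord m v - σ v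
  coord-p-≡ 0F v = solve 3 (λ a b c → :- b :- c := a :- (a :+ b :+ c)) refl (c₁ v) (c₂ v) (c₃ v)
  coord-p-≡ 1F v = solve 3 (λ a b c → :- a :- c := b :- (a :+ b :+ c)) refl (c₁ v) (c₂ v) (c₃ v)
  coord-p-≡ 2F v = solve 3 (λ a b c → :- a :- b := c :- (a :+ b :+ c)) refl (c₁ v) (c₂ v) (c₃ v)

  σ-p : ∀ m v → σ (p m v) ≡ 0#
  σ-p 0F v = solve 3 (λ a b c → :- b :- c :+ b :+ c := con 0ℤ) refl (c₁ v) (c₂ v) (c₃ v)
  σ-p 1F v = solve 3 (λ a b c → a :+ (:- a :- c) :+ c := con 0ℤ) refl (c₁ v) (c₂ v) (c₃ v)
  σ-p 2F v = solve 3 (λ a b c → a :+ b :+ (:- a :- b) := con 0ℤ) refl (c₁ v) (c₂ v) (c₃ v)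

  σ-combination-p : ∀ a b c m m′ m″ v → σ (((a · p m v) +ᵖ (b · p m′ v)) +ᵖ (c · p m″ v)) ≡ 0#
  σ-combination-p a b c m m′ m″ v = begin
    σ (((a · p m v) +ᵖ (b · p m′ v)) +ᵖ (c · p m″ v))
      ≡⟨ σ-combination a b c (p m v) (p m′ v) (p m″ v) ⟩
    a * σ (p m v) + b * σ (p m′ v) + c * σ (p m″ v)
      ≡⟨ cong₂ _+_ (cong₂ _+_ (cong (a *_) (σ-p m v)) (cong (b *_) (σ-p m′ v))) (cong (c *_) (σ-p m″ v)) ⟩
    a * 0# + b * 0# + c * 0#
      ≡⟨ solve 3 (λ a b c → a :* con 0ℤ :+ b :* con 0ℤ :+ c :* con 0ℤ := con 0ℤ) refl a b c ⟩
    0#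
      ∎

  weight : Fin 3 → Carrier → Carrier → Carrier → Carrier
  weight l a b c = lookup (a ∷ b ∷ c ∷ []) l

  coord-comb : ∀ l v a b c → a + b + c ≡ 1# →
    coord l (comb v a b c) ≡ coord l v - weight l a b c * σ v
  coord-comb l v a b c a+b+c≡1 = begin
    coord l (comb v a b c)
      ≡⟨ expand l ⟩
    (a + b + c) * coord l v - weight l a b c * σ v
      ≡⟨ cong (λ t → t * coord l v - weight l a b c * σ v) a+b+c≡1 ⟩
    1# * coord l v - weight l a b c * σ v
      ≡⟨ cong (_- weight l a b c * σ v) (*-idˡ (coord l v)) ⟩
    coord l v - weight l a b c * σ v
      ∎
    where
    expand : ∀ l → coord l (comb v a b c) ≡ (a + b + c) * coord l v - weight l a b c * σ v
    expand 0F = solve 6 (λ a b c x y z →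
        a :* (:- y :- z) :+ b :* x :+ c :* x := (a :+ b :+ c) :* x :- a :* (x :+ y :+ z))
      refl a b c (c₁ v) (c₂ v) (c₃ v)
    expand 1F = solve 6 (λ a b c x y z →
        a :* y :+ b :* (:- x :- z) :+ c :* y := (a :+ b :+ c) :* y :- b :* (x :+ y :+ z))
      refl a b c (c₁ v) (c₂ v) (c₃ v)
    expand 2F = solve 6 (λ a b c x y z →
        a :* z :+ b :* z :+ c :* (:- x :- y) := (a :+ b :+ c) :* z :- c :* (x :+ y :+ z))
      refl a b c (c₁ v) (c₂ v) (c₃ v)

  Tri△⇒≤ : ∀ {u y} → 0# < σ u → Tri△ u y → ∀ l → coord l y ≤ coord l u
  Tri△⇒≤ {u} 0<σu (a , b , c , 0≤a , 0≤b , 0≤c , a+b+c≡1 , refl) l =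
    subst (_≤ coord l u) (sym (coord-comb l u a b c a+b+c≡1))
      (0≤d⇒x-d≤x (coord l u) (0≤a⇒0≤a*b (lookup⁺ {P = 0# ≤_} (0≤a ∷ 0≤b ∷ 0≤c ∷ []) l) 0<σu))

  A⇒< : ∀ {u y} → 0# < σ u → A u y → ∀ l → coord l y < coord l u
  A⇒< {u} 0<σu (a , b , c , 0<a , 0<b , 0<c , a+b+c≡1 , refl) l =
    subst (_< coord l u) (sym (coord-comb l u a b c a+b+c≡1))
      (0<d⇒x-d<x (coord l u) (*-pos (lookup⁺ {P = 0# <_} (0<a ∷ 0<b ∷ 0<c ∷ []) l) 0<σu))

  A⇒σ≡0 : ∀ {u y} → A u y → σ y ≡ 0#
  A⇒σ≡0 {u} (a , b , c , _ , _ , _ , _ , refl) = σ-combination-p a b c 0F 1F 2F u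

  <⇒A : ∀ {v y} → 0# < σ v → σ y ≡ 0# → (∀ l → coord l y < coord l v) → A v y
  <⇒A {v} {y} 0<σv σy≡0 y<v =
    a 0F , a 1F , a 2F , 0<a 0F , 0<a 1F , 0<a 2F , Σa≡1 , sym (Pt-ext comb≡y)
    where
    σv⁻¹ : Carrier
    σv⁻¹ = (σ v ⁻¹) (0<⇒≢0 0<σv)
    a : Fin 3 → Carrier
    a l = (coord l v - coord l y) ÷⟨ 0<σv ⟩
    0<a : ∀ l → 0# < a l
    0<a l = 0<d⇒0<d÷s 0<σv (x<y⇒0<y-x (y<v l))
    Σa≡1 : a 0F + a 1F + a 2F ≡ 1#
    Σa≡1 = begin
      a 0F + a 1F + a 2F  ≡⟨ solve 7 (λ x₁ x₂ x₃ y₁ y₂ y₃ t →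
                                (x₁ :- y₁) :* t :+ (x₂ :- y₂) :* t :+ (x₃ :- y₃) :* t
                                := ((x₁ :+ x₂ :+ x₃) :- (y₁ :+ y₂ :+ y₃)) :* t)
                              refl (c₁ v) (c₂ v) (c₃ v) (c₁ y) (c₂ y) (c₃ y) σv⁻¹ ⟩
      (σ v - σ y) * σv⁻¹  ≡⟨ cong (λ s → (σ v - s) * σv⁻¹) σy≡0 ⟩
      (σ v - 0#) * σv⁻¹   ≡⟨ cong (λ s → (σ v + s) * σv⁻¹) -0#≈0# ⟩
      (σ v + 0#) * σv⁻¹   ≡⟨ cong (_* σv⁻¹) (+-identityʳ (σ v)) ⟩
      σ v ÷⟨ 0<σv ⟩       ≡⟨ ÷-self 0<σv ⟩
      1#                  ∎
    comb≡y : ∀ l → coord l (comb v (a 0F) (a 1F) (a 2F)) ≡ coord l y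
    comb≡y l = begin
      coord l (comb v (a 0F) (a 1F) (a 2F))
        ≡⟨ coord-comb l v _ _ _ Σa≡1 ⟩
      coord l v - weight l (a 0F) (a 1F) (a 2F) * σ v
        ≡⟨ cong (λ w → coord l v - w * σ v) (lookup∘tabulate a l) ⟩
      coord l v - a l * σ v
        ≡⟨ cong (λ w → coord l v - w) (÷-*-cancel _ 0<σv) ⟩
      coord l v - (coord l v - coord l y)
        ≡⟨ solve 2 (λ x y → x :- (x :- y) := y) refl (coord l v) (coord l y) ⟩
      coord l y
        ∎

  A-mono : ∀ {u v y} → 0# < σ u → 0# < σ v → (∀ l → coord l v ≤ coord l u) → A v y → A u y
  A-mono 0<σu 0<σv v≤u Avy = <⇒A 0<σu (A⇒σ≡0 Avy) (λ l → <-≤-trans (A⇒< 0<σv Avy l) (v≤u l))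

  ray : Fin 3 → Fin 3 → Fin 3 → Pt → Carrier → Carrier → Pt
  ray k i j v α β = (((1# + α + β) · p k v) +ᵖ ((- α) · p i v)) +ᵖ ((- β) · p j v)

  coord-ray-i : ∀ {k i j} → k ≢ i → j ≢ i → ∀ v α β →
    coord i (ray k i j v α β) ≡ coord i v + α * σ v
  coord-ray-i {k} {i} {j} k≢i j≢i v α β = begin
    coord i (ray k i j v α β)
      ≡⟨ coord-combination i _ _ _ (p k v) (p i v) (p j v) ⟩
    (1# + α + β) * coord i (p k v) + (- α) * coord i (p i v) + (- β) * coord i (p j v)
      ≡⟨ cong₂ (λ s t → (1# + α + β) * s + (- α) * coord i (p i v) + (- β) * t)
               (coord-p-≢ k≢i v) (coord-p-≢ j≢i v) ⟩
    (1# + α + β) * coord i v + (- α) * coord i (p i v) + (- β) * coord i v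
      ≡⟨ cong (λ s → (1# + α + β) * coord i v + (- α) * s + (- β) * coord i v) (coord-p-≡ i v) ⟩
    (1# + α + β) * coord i v + (- α) * (coord i v - σ v) + (- β) * coord i v
      ≡⟨ solve 4 (λ a b x s → (con 1ℤ :+ a :+ b) :* x :+ :- a :* (x :- s) :+ :- b :* x := x :+ a :* s)
           refl α β (coord i v) (σ v) ⟩
    coord i v + α * σ v
      ∎

  coord-ray-j : ∀ {k i j} → k ≢ j → i ≢ j → ∀ v α β →
    coord j (ray k i j v α β) ≡ coord j v + β * σ v
  coord-ray-j {k} {i} {j} k≢j i≢j v α β = begin
    coord j (ray k i j v α β)
      ≡⟨ coord-combination j _ _ _ (p k v) (p i v) (p j v) ⟩
    (1# + α + β) * coord j (p k v) + (- α) * coord j (p i v) + (- β) * coord j (p j v)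
      ≡⟨ cong₂ (λ s t → (1# + α + β) * s + (- α) * t + (- β) * coord j (p j v))
               (coord-p-≢ k≢j v) (coord-p-≢ i≢j v) ⟩
    (1# + α + β) * coord j v + (- α) * coord j v + (- β) * coord j (p j v)
      ≡⟨ cong (λ s → (1# + α + β) * coord j v + (- α) * coord j v + (- β) * s) (coord-p-≡ j v) ⟩
    (1# + α + β) * coord j v + (- α) * coord j v + (- β) * (coord j v - σ v)
      ≡⟨ solve 4 (λ a b x s → (con 1ℤ :+ a :+ b) :* x :+ :- a :* x :+ :- b :* (x :- s) := x :+ b :* s)
           refl α β (coord j v) (σ v) ⟩
    coord j v + β * σ v
      ∎

  Ray⇒≤ : ∀ {k i j v y} → 0# < σ v → k ≢ i → j ≢ i → Ray k i j v y → coord i v ≤ coord i y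
  Ray⇒≤ {i = i} {v = v} 0<σv k≢i j≢i (α , β , 0≤α , _ , refl) =
    subst (coord i v ≤_) (sym (coord-ray-i k≢i j≢i v α β))
      (0≤d⇒x≤x+d (coord i v) (0≤a⇒0≤a*b 0≤α 0<σv))

  ≤⇒Ray : ∀ {k i j v y} → 0# < σ v → i ≢ j → j ≢ k → i ≢ k → σ y ≡ 0# →
    coord i v ≤ coord i y → coord j v ≤ coord j y → Ray k i j v y
  ≤⇒Ray {k} {i} {j} {v} {y} 0<σv i≢j j≢k i≢k σy≡0 vᵢ≤yᵢ vⱼ≤yⱼ =
    α , β , 0≤d⇒0≤d÷s 0<σv (x≤y⇒0≤y-x vᵢ≤yᵢ) , 0≤d⇒0≤d÷s 0<σv (x≤y⇒0≤y-x vⱼ≤yⱼ) ,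
    σ-ext i≢j j≢k i≢k (trans σy≡0 (sym (σ-combination-p _ _ _ k i j v))) yᵢ≡rayᵢ yⱼ≡rayⱼ
    where
    α β : Carrier
    α = (coord i y - coord i v) ÷⟨ 0<σv ⟩
    β = (coord j y - coord j v) ÷⟨ 0<σv ⟩
    yᵢ≡rayᵢ : coord i y ≡ coord i (ray k i j v α β)
    yᵢ≡rayᵢ = sym (begin
      coord i (ray k i j v α β)            ≡⟨ coord-ray-i (≢-sym i≢k) (≢-sym i≢j) v α β ⟩
      coord i v + α * σ v                  ≡⟨ cong (coord i v +_) (÷-*-cancel _ 0<σv) ⟩
      coord i v + (coord i y - coord i v)  ≡⟨ x+[y-x]≡y (coord i v) (coord i y) ⟩
      coord i y                            ∎)
    yⱼ≡rayⱼ : coord j y ≡ coord j (ray k i j v α β)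
    yⱼ≡rayⱼ = sym (begin
      coord j (ray k i j v α β)            ≡⟨ coord-ray-j (≢-sym j≢k) i≢j v α β ⟩
      coord j v + β * σ v                  ≡⟨ cong (coord j v +_) (÷-*-cancel _ 0<σv) ⟩
      coord j v + (coord j y - coord j v)  ≡⟨ x+[y-x]≡y (coord j v) (coord j y) ⟩
      coord j y                            ∎)

  Ray-p⇔ : ∀ {i j k v x} → 0# < σ v → i ≢ j → j ≢ k → i ≢ k → coord k v ≤ coord k x →
    Ray i j k v (p i x) ⇔ coord j v ≤ coord j x
  Ray-p⇔ {i} {j} {k} {v} {x} 0<σv i≢j j≢k i≢k vₖ≤xₖ = mk⇔
    (λ r → subst (coord j v ≤_) (coord-p-≢ i≢j x) (Ray⇒≤ 0<σv i≢j (≢-sym j≢k) r))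
    (λ vⱼ≤xⱼ → ≤⇒Ray 0<σv j≢k (≢-sym i≢k) (≢-sym i≢j) (σ-p i x)
      (subst (coord j v ≤_) (sym (coord-p-≢ i≢j x)) vⱼ≤xⱼ)
      (subst (coord k v ≤_) (sym (coord-p-≢ i≢k x)) vₖ≤xₖ))

module CompetitionGraph (ℝ : RealField) where
  open RealField ℝ
  open FieldOrder ℝ
  open Geometry ℝ
  open Coordinates ℝ

  arrow-≤ : ∀ {k x y} → 0# < σ x → Arrow k x y → ∀ {l} → k ≢ l → coord l y ≤ coord l x
  arrow-≤ {k} {x} {y} 0<σx (_ , △) {l} k≢l = subst (_≤ coord l x) (coord-p-≢ k≢l y) (Tri△⇒≤ 0<σx △ l)

  -- Otherwise y would lie weakly below x, so A(y) ⊆ A(x), contradicting that they cross.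
  arrow-< : ∀ {k x y} → 0# < σ x → 0# < σ y → Arrow k x y → coord k x < coord k y
  arrow-< {k} {x} {y} 0<σx 0<σy x→y@((_ , _ , z , Ay-z , ¬Ax-z) , _) with <-or-≥ (coord k x) (coord k y)
  ... | inj₁ xₖ<yₖ = xₖ<yₖ
  ... | inj₂ yₖ≤xₖ =
    contradiction (A-mono 0<σx 0<σy y≤x Ay-z) ¬Ax-z
    where
    y≤x : ∀ l → coord l y ≤ coord l x
    y≤x = all-from-≢ (λ l → coord l y ≤ coord l x) yₖ≤xₖ (arrow-≤ 0<σx x→y)

  ¬common-prey : ∀ {S v x z} → v ≢ x → ¬ Adj S v x → z ∈ S → z ≺ v → ¬ z ≺ x
  ¬common-prey v≢x ¬v~x z∈S z≺v z≺x = ¬v~x (v≢x , _ , z∈S , z≺v , z≺x)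

  below-off-k⇒<ₖ : ∀ {S k v w x} → (∀ {l} → k ≢ l → coord l w ≤ coord l v) →
    Adj S w x → v ≢ x → ¬ Adj S v x → coord k v < coord k x
  below-off-k⇒<ₖ {k = k} {v} {w} {x} w≤v (_ , z , z∈S , z≺w , z≺x) v≢x ¬v~x
    with <-or-≥ (coord k v) (coord k x)
  ... | inj₁ vₖ<xₖ = vₖ<xₖ
  ... | inj₂ xₖ≤vₖ = contradiction z≺x (¬common-prey v≢x ¬v~x z∈S (<⇒≺ z<v))
    where
    z<v : ∀ l → coord l z < coord l v
    z<v = all-from-≢ (λ l → coord l z < coord l v)
      (<-≤-trans (≺⇒< z≺x k) xₖ≤vₖ) (λ {l} k≢l → <-≤-trans (≺⇒< z≺w l) (w≤v k≢l))

  ¬both-≤ : ∀ {S i j k u v x} → i ≢ j → j ≢ k → i ≢ k → Adj S u v → v ≢ x → ¬ Adj S v x →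
    coord k v < coord k x → ¬ (coord i v ≤ coord i x × coord j v ≤ coord j x)
  ¬both-≤ {i = i} {j} {k} {x = x} i≢j j≢k i≢k (_ , z , z∈S , _ , z≺v) v≢x ¬v~x vₖ<xₖ
    (vᵢ≤xᵢ , vⱼ≤xⱼ) = ¬common-prey v≢x ¬v~x z∈S z≺v (<⇒≺ z<x)
    where
    z<x : ∀ l → coord l z < coord l x
    z<x = all-distinct i≢j j≢k i≢k (λ l → coord l z < coord l x)
      (<-≤-trans (≺⇒< z≺v i) vᵢ≤xᵢ) (<-≤-trans (≺⇒< z≺v j) vⱼ≤xⱼ) (<-trans (≺⇒< z≺v k) vₖ<xₖ)

  some-≤ : ∀ {S i j k u v x} → i ≢ j → j ≢ k → i ≢ k → Adj S u x → v ≢ x → ¬ Adj S v x →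
    coord k u < coord k v → coord i v ≤ coord i x ⊎ coord j v ≤ coord j x
  some-≤ {i = i} {j} {k} {v = v} i≢j j≢k i≢k (_ , z , z∈S , z≺u , z≺x) v≢x ¬v~x uₖ<vₖ
    with <-or-≥ (coord i z) (coord i v) | <-or-≥ (coord j z) (coord j v)
  ... | inj₂ vᵢ≤zᵢ | _          = inj₁ (<⇒≤ (≤-<-trans vᵢ≤zᵢ (≺⇒< z≺x i)))
  ... | inj₁ _     | inj₂ vⱼ≤zⱼ = inj₂ (<⇒≤ (≤-<-trans vⱼ≤zⱼ (≺⇒< z≺x j)))
  ... | inj₁ zᵢ<vᵢ | inj₁ zⱼ<vⱼ = contradiction z≺x (¬common-prey v≢x ¬v~x z∈S (<⇒≺ z<v))
    where
    z<v : ∀ l → coord l z < coord l v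
    z<v = all-distinct i≢j j≢k i≢k (λ l → coord l z < coord l v)
      zᵢ<vᵢ zⱼ<vⱼ (<-trans (≺⇒< z≺u k) uₖ<vₖ)

mainTheorem9 : (ℝ : RealField) → let open Geometry ℝ in
  (S : List Pt) → All H₊ S →
  (u v w x : Pt) → Diamond S u v w x →
  (i j k : Fin 3) → i ≢ j → j ≢ k → i ≢ k →
  TailBiting3 k u v w →
  (Ray i j k v (p i x) × ¬ Ray j i k v (p j x)) ⊎
  (¬ Ray i j k v (p i x) × Ray j i k v (p j x))
mainTheorem9 ℝ S H₊S u v w x (u∈S , v∈S , _ , _ , _ , _ , _ , _ , v≢x , _ , u~v , _ , u~x , _ , w~x , ¬v~x)
             i j k i≢j j≢k i≢k (u→v , _ , v→w) =
  exclusive-or (Ray-p⇔ 0<σv i≢j j≢k i≢k vₖ≤xₖ) (Ray-p⇔ 0<σv (≢-sym i≢j) i≢k j≢k vₖ≤xₖ)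
    (some-≤ i≢j j≢k i≢k u~x v≢x ¬v~x (arrow-< 0<σu 0<σv u→v))
    (¬both-≤ i≢j j≢k i≢k u~v v≢x ¬v~x vₖ<xₖ)
  where
  open RealField ℝ using (0#; _<_; _≤_)
  open Geometry ℝ using (coord)
  open FieldOrder ℝ using (<⇒≤)
  open Coordinates ℝ
  open CompetitionGraph ℝ
  0<σu : 0# < σ u
  0<σu = ListAll.lookup H₊S u∈S
  0<σv : 0# < σ v
  0<σv = ListAll.lookup H₊S v∈S
  vₖ<xₖ : coord k v < coord k x
  vₖ<xₖ = below-off-k⇒<ₖ (arrow-≤ 0<σv v→w) w~x v≢x ¬v~x
  vₖ≤xₖ : coord k v ≤ coord k x
  vₖ≤xₖ = <⇒≤ vₖ<xₖ
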